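{- Let $\mathcal G$ be the category of finite groups and $\mathcal S_a$ the category defined below. The functor $S_a:\mathcal G\to\mathcal S_a$ is left adjoint to the functor $\mathrm{Rad}:\mathcal S_a\to\mathcal G$; that is, there are bijections $\operatorname{Hom}_{\mathcal S_a}(S_a(G),T)\to\operatorname{Hom}_{\mathcal G}(G,\mathrm{Rad}(T))$, natural in the finite group $G$ and the finite association scheme $T$.
   Context: An association scheme on a finite set $X$ is a partition $S$ of $X\times X$ into nonempty subsets such that $1_X=\{(x,x):x\in X\}\in S$; for each $s\in S$, $s^*=\{(x,y):(y,x)\in s\}\in S$; and for all $p,q,r\in S$ there is an integer $a_{pq}^r\ge0$ with $|\{y:(x,y)\in p,(y,z)\in q\}|=a_{pq}^r$ whenever $(x,z)\in r$. Complex product: $PQ=\{r:a_{pq}^r>0\text{ for some }p\in P,q\in Q\}$. The valency of $s$ is $n_s=a_{ss^*}^{1_X}$ (equal to $|\{y:(x,y)\in s\}|$ for any $x$); $s$ is thin if $n_s=1$, and a scheme is thin if all its elements are. A morphism from a scheme $S$ on $X$ to a scheme $T$ on $Y$ is a function $\phi:X\cup S\to Y\cup T$ with $\phi(X)\subseteq Y$, $\phi(S)\subseteq T$, and $(\phi(x_1),\phi(x_2))\in\phi(s)$ whenever $(x_1,x_2)\in s$; it is admissible if whenever $(\phi(x),y)\in\phi(s)$ there is $x'\in X$ with $\phi(x')=y$ and $(x,x')\in s$. Admissible morphisms $\phi,\phi'$ from $S$ to $T$ are algebraically equivalent if $\phi(s)=\phi'(s)$ for all $s\in S$. $\mathcal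 S_a$ is the category whose objects are association schemes on finite sets and whose morphisms are algebraic equivalence classes of admissible morphisms. For a finite group $G$, $S(G)$ is the thin scheme on $G$ consisting of the sets $g\tilde{\ }=\{(g_1,g_2):g_2=g_1g\}$, $g\in G$; for a group homomorphism $f:G\to H$, $S(f)$ sends $g\mapsto f(g)$ and $g\tilde{\ }\mapsto f(g)\tilde{\ }$ (an admissible morphism), and $S_a(f)$ is its algebraic equivalence class; $S_a(G)=S(G)$. For a scheme $T$, $\mathrm{Rad}(T)$ is the group of singletons $\{t\}$, $t\in T$ thin, under complex product; for an admissible $\phi$, $\mathrm{Rad}(\phi)(\{s\})=\{\phi(s)\}$, which depends only on the algebraic equivalence class of $\phi$; these assignments are functors. -}

module Defs where

open import Level using (0ℓ)
open import Data.Nat using (ℕ; _<_)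
open import Data.Fin using (Fin)
open import Data.Fin.Properties using (_≟_)
open import Data.List using (List; length; filter; allFin)
open import Data.Product using (Σ; ∃; ∃-syntax; _×_; _,_; proj₁; proj₂)
open import Data.Product.Properties using ()
open import Relation.Nullary.Decidable using (_×-dec_)
open import Relation.Unary using (Pred; Decidable)
open import Relation.Binary.PropositionalEquality
open import Function.Bundles using (_⇔_)
open import Algebra.Structures using (IsGroup)
open import Algebra.Bundles using (Group)
open import Algebra.Bundles.Raw using (RawGroup)
open import Algebra.Morphism.Structures using (module GroupMorphisms)
import Algebra.Properties.Group as GP

count : ∀ {n} {P : Pred (Fin n) 0ℓ} → Decidable P → ℕ
count {n} P? = length (filter P? (allFin n))

-- Raw data of a partition of X × X, X = Fin points, into classes
-- indexed by Fin classes: (x , y) lies in class s iff rel x y ≡ s.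

record RawScheme : Set where
  field
    points  : ℕ
    classes : ℕ
    rel     : Fin points → Fin points → Fin classes

record Scheme : Set where
  field
    raw : RawScheme
  open RawScheme raw public
  field
    nonempty  : ∀ s → ∃[ x ] ∃[ y ] rel x y ≡ s
    one       : Fin classes
    one-diag  : ∀ x y → (rel x y ≡ one) ⇔ (x ≡ y)
    _*        : Fin classes → Fin classes
    *-conv    : ∀ s x y → (rel x y ≡ s *) ⇔ (rel y x ≡ s)
    a         : Fin classes → Fin classes → Fin classes → ℕ
    a-count   : ∀ p q r x z → rel x z ≡ r →
                count (λ y → (rel x y ≟ p) ×-dec (rel y z ≟ q)) ≡ a p q r

  -- valency n_s = |{ y : (x , y) ∈ s }| (for any x)
  -- s is thin iff n_s = 1
  Thin : Fin classes → Set
  Thin s = ∀ x → count (λ y → rel x y ≟ s) ≡ 1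

-- Morphisms (only the underlying partitions are involved)

record AdmMor (S T : RawScheme) : Set where
  private
    module S = RawScheme S
    module T = RawScheme T
  field
    pt  : Fin S.points → Fin T.points
    cl  : Fin S.classes → Fin T.classes
    hom : ∀ x₁ x₂ → T.rel (pt x₁) (pt x₂) ≡ cl (S.rel x₁ x₂)
    adm : ∀ x y s → T.rel (pt x) y ≡ cl s →
          ∃[ x′ ] (pt x′ ≡ y × S.rel x x′ ≡ s)

-- algebraic equivalence (equality of morphisms in 𝒮ₐ)
AlgEq : ∀ {S T} → AdmMor S T → AdmMor S T → Set
AlgEq φ φ′ = ∀ s → AdmMor.cl φ s ≡ AdmMor.cl φ′ s

_∘ₘ_ : ∀ {R S T} → AdmMor S T → AdmMor R S → AdmMor R T
_∘ₘ_ {R} {S} {T} ψ φ = record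
  { pt  = λ x → ψ.pt (φ.pt x)
  ; cl  = λ s → ψ.cl (φ.cl s)
  ; hom = λ x₁ x₂ → trans (ψ.hom (φ.pt x₁) (φ.pt x₂)) (cong ψ.cl (φ.hom x₁ x₂))
  ; adm = λ x y r e →
      let (u , pu , su) = ψ.adm (φ.pt x) y (φ.cl r) e
          (v , pv , sv) = φ.adm x u r su
      in v , trans (cong ψ.pt pv) pu , sv
  }
  where
    module ψ = AdmMor ψ
    module φ = AdmMor φ

record FinGroup : Set where
  field
    order   : ℕ
    _∙_     : Fin order → Fin order → Fin order
    ε       : Fin order
    _⁻¹     : Fin order → Fin order
    isGroup : IsGroup _≡_ _∙_ ε _⁻¹

  group : Group 0ℓ 0ℓ
  group = record { isGroup = isGroup }

  open Group group public using (rawGroup)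

record GroupHom (G H : FinGroup) : Set where
  field
    ⟦_⟧   : Fin (FinGroup.order G) → Fin (FinGroup.order H)
    isHom : GroupMorphisms.IsGroupHomomorphism
              (FinGroup.rawGroup G) (FinGroup.rawGroup H) ⟦_⟧

-- The thin scheme S(G): (g₁ , g₂) ∈ g~ iff g₂ = g₁ g iff g₁⁻¹ g₂ = g

SRaw : FinGroup → RawScheme
SRaw G = record
  { points = order ; classes = order ; rel = λ g₁ g₂ → (g₁ ⁻¹) ∙ g₂ }
  where open FinGroup G

SMor : ∀ {G H} → GroupHom G H → AdmMor (SRaw G) (SRaw H)
SMor {G} {H} f = record
  { pt  = ⟦_⟧
  ; cl  = ⟦_⟧
  ; hom = λ x₁ x₂ → sym (trans (homo (x₁ G.⁻¹) x₂)
                         (cong (H._∙ ⟦ x₂ ⟧) (⁻¹-homo x₁)))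
  ; adm = λ x y s e →
      (x G.∙ s)
      , trans (homo x s)
          (trans (cong (⟦ x ⟧ H.∙_) (sym e)) (HP.\\-leftDividesˡ ⟦ x ⟧ y))
      , GP.\\-leftDividesʳ G.group x s
  }
  where
    module G = FinGroup G
    module H = FinGroup H
    module HP = GP H.group
    open GroupHom f
    open GroupMorphisms.IsGroupHomomorphism isHom

-- Homomorphisms G → Rad(T), unfolded: maps g ↦ {f g} with f g thin and
-- {f g}{f h} = {f (g h)} as complex products, where the complex product
-- of singletons {p}{q} is { r : a_pq^r > 0 }.

record RadHom (G : FinGroup) (T : Scheme) : Set where
  private
    module G = FinGroup G
    module T = Scheme T
  field
    map  : Fin G.order → Fin T.classes
    thin : ∀ g → T.Thin (map g)
    mult : ∀ g h r → (0 < T.a (map g) (map h) r) ⇔ (r ≡ map (g G.∙ h))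

RadHom≈ : ∀ {G T} → RadHom G T → RadHom G T → Set
RadHom≈ f f′ = ∀ g → RadHom.map f g ≡ RadHom.map f′ g

module Submission where

-- The bijection Hom(S_a(G), T) → Hom(G, Rad(T)) sends an admissible morphism
-- ψ to its action on classes, g ↦ ψ(g~).  Since algebraic equivalence is
-- equality of the class maps, this is well defined and injective on
-- equivalence classes by definition, and naturality in G and T holds by
-- computation.  The content lies in two facts:
--   * for an admissible ψ, every ψ(g~) is thin and ψ(g~)ψ(h~) = {ψ((gh)~)};
--   * conversely every homomorphism h : G → Rad(T) is the class map of an
--     admissible morphism, whose point map sends g to the unique h(g)-successor
--     of a fixed base point.

open import Level using (0ℓ)
open import Data.Nat using (ℕ; _<_)
open import Data.Fin using (Fin)
open import Data.Fin.Properties using (_≟_)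
open import Data.List using (List; []; _∷_; length; filter; allFin)
open import Data.List.Properties using (filter-some; filter-≐)
open import Data.List.Membership.Propositional using (_∈_; lose)
open import Data.List.Membership.Propositional.Properties
  using (∈-filter⁺; ∈-filter⁻; ∈-allFin)
open import Data.List.Relation.Unary.Any using (here; there)
open import Data.List.Relation.Unary.All using (_∷_)
open import Data.List.Relation.Unary.AllPairs using (_∷_)
open import Data.List.Relation.Unary.Unique.Propositional using (Unique)
open import Data.List.Relation.Unary.Unique.Propositional.Properties
  using (allFin⁺; filter⁺)
open import Data.Product using (Σ; ∃; ∃-syntax; _×_; _,_; proj₁; proj₂)
open import Data.Empty using (⊥-elim)
open import Relation.Nullary.Decidable using (_×-dec_)
open import Relation.Unary using (Pred; Decidable; _≐_)
open import Relation.Binary.PropositionalEquality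
open import Function.Bundles using (_⇔_; mk⇔; Equivalence)
open import Algebra.Structures using (IsGroup)
import Algebra.Properties.Group as GroupProperties
open import Defs

singleton-length : ∀ {A : Set} {xs : List A} {y : A} → Unique xs →
                   (∀ {x} → x ∈ xs → x ≡ y) → y ∈ xs → length xs ≡ 1
singleton-length {xs = _ ∷ []} _ _ _ = refl
singleton-length {xs = _ ∷ _ ∷ _} ((a≢b ∷ _) ∷ _) all≡y _ =
  ⊥-elim (a≢b (trans (all≡y (here refl)) (sym (all≡y (there (here refl))))))

module Counting {n : ℕ} {P : Pred (Fin n) 0ℓ} (P? : Decidable P) where

  count-witness : 0 < count P? → ∃ P
  count-witness pos with filter P? (allFin n) in eq | pos
  ... | x ∷ _ | _ =
    x , proj₂ (∈-filter⁻ P? {xs = allFin n} (subst (x ∈_) (sym eq) (here refl)))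

  count-pos : ∀ {x} → P x → 0 < count P?
  count-pos {x} px = filter-some P? (lose (∈-allFin x) px)

  count-one⇒unique : count P? ≡ 1 → ∀ {a b} → P a → P b → a ≡ b
  count-one⇒unique one {a} {b} pa pb with filter P? (allFin n) in eq | one
  ... | z ∷ [] | _ = trans (in-singleton pa) (sym (in-singleton pb))
    where
      in-singleton : ∀ {x} → P x → x ≡ z
      in-singleton {x} px with subst (x ∈_) eq (∈-filter⁺ P? (∈-allFin x) px)
      ... | here x≡z = x≡z

  unique⇒count-one : ∀ {y} → P y → (∀ x → P x → x ≡ y) → count P? ≡ 1
  unique⇒count-one {y} py unique =
    singleton-length (filter⁺ P? (allFin⁺ n))
      (λ x∈ → unique _ (proj₂ (∈-filter⁻ P? {xs = allFin n} x∈)))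
      (∈-filter⁺ P? (∈-allFin y) py)

open Counting

count-cong : ∀ {n} {P Q : Pred (Fin n) 0ℓ} (P? : Decidable P) (Q? : Decidable Q) →
             P ≐ Q → count P? ≡ count Q?
count-cong {n} P? Q? P≐Q = cong length (filter-≐ P? Q? P≐Q (allFin n))

module SchemeFacts (T : Scheme) where
  open Scheme T

  successors : Fin points → Fin classes → ℕ
  successors x s = count (λ y → rel x y ≟ s)

  -- It is the valency n_s = a_{s s*}^{1_X}: the s-successors y of x are
  -- exactly the y with (x , y) ∈ s and (y , x) ∈ s*.
  successors≡valency : ∀ x s → successors x s ≡ a s (s *) one
  successors≡valency x s = begin
    count (λ y → rel x y ≟ s)
      ≡⟨ count-cong (λ y → rel x y ≟ s) (λ y → (rel x y ≟ s) ×-dec (rel y x ≟ s *))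
           ((λ e → e , Equivalence.from (*-conv s _ x) e) , proj₁) ⟩
    count (λ y → (rel x y ≟ s) ×-dec (rel y x ≟ s *))
      ≡⟨ a-count s (s *) one x x (Equivalence.from (one-diag x x) refl) ⟩
    a s (s *) one ∎
    where open ≡-Reasoning

  successors-const : ∀ x x′ s → successors x s ≡ successors x′ s
  successors-const x x′ s = trans (successors≡valency x s) (sym (successors≡valency x′ s))

  -- Every class is met from every point (classes are nonempty and the
  -- valency does not depend on the point).
  reach : ∀ x s → ∃[ y ] rel x y ≡ s
  reach x s with nonempty s
  ... | u , _ , e = count-witness (λ y → rel x y ≟ s)
                      (subst (0 <_) (successors-const u x s) (count-pos (λ y → rel u y ≟ s) e))

  path⇒a-pos : ∀ {p q r x y z} → rel x z ≡ r → rel x y ≡ p → rel y z ≡ q → 0 < a p q r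
  path⇒a-pos {p} {q} {r} {x} {z = z} xz xy yz =
    subst (0 <_) (a-count p q r x z xz) (count-pos (λ y → (rel x y ≟ p) ×-dec (rel y z ≟ q)) (xy , yz))

  a-pos⇒path : ∀ {p q r x z} → rel x z ≡ r → 0 < a p q r →
               ∃[ y ] (rel x y ≡ p × rel y z ≡ q)
  a-pos⇒path {p} {q} {r} {x} {z} xz pos =
    count-witness (λ y → (rel x y ≟ p) ×-dec (rel y z ≟ q))
      (subst (0 <_) (sym (a-count p q r x z xz)) pos)

  thin-unique : ∀ {s x y y′} → Thin s → rel x y ≡ s → rel x y′ ≡ s → y ≡ y′
  thin-unique {s} {x} thin = count-one⇒unique (λ y → rel x y ≟ s) (thin x)

  thin-from-point : ∀ x₀ y₀ s → rel x₀ y₀ ≡ s → (∀ y → rel x₀ y ≡ s → y ≡ y₀) → Thin s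
  thin-from-point x₀ y₀ s x₀y₀ unique x =
    trans (successors-const x x₀ s) (unique⇒count-one (λ y → rel x₀ y ≟ s) x₀y₀ unique)

  -- For thin p and q the complex product {p}{q} has at most one element:
  -- from a fixed x the paths x →p y →q z are unique.
  thin-product-unique : ∀ {p q r r′} → Thin p → Thin q →
                        0 < a p q r → 0 < a p q r′ → r ≡ r′
  thin-product-unique {r = r} {r′} thin-p thin-q pos pos′
    with nonempty r
  ... | x , z , xz with reach x r′
  ... | z′ , xz′ with a-pos⇒path xz pos | a-pos⇒path xz′ pos′
  ... | y , xy , yz | y′ , xy′ , y′z′ with thin-unique thin-p xy xy′
  ... | refl with thin-unique thin-q yz y′z′
  ... | refl = trans (sym xz) xz′

module GroupFacts (G : FinGroup) where
  open FinGroup G public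
  open GroupProperties group public using (\\-leftDividesˡ; \\-leftDividesʳ)
  open GroupProperties group using (ε⁻¹≈ε)
  open IsGroup isGroup using (identityˡ)

  ε\\ : ∀ g → (ε ⁻¹) ∙ g ≡ g
  ε\\ g = trans (cong (_∙ g) ε⁻¹≈ε) (identityˡ g)

module FromMorphism (G : FinGroup) (T : Scheme) (ψ : AdmMor (SRaw G) (Scheme.raw T)) where
  open Scheme T
  open SchemeFacts T
  module G = GroupFacts G
  open AdmMor ψ

  base : Fin points
  base = pt G.ε

  base-rel : ∀ g → rel base (pt g) ≡ cl g
  base-rel g = trans (hom G.ε g) (cong cl (G.ε\\ g))

  base-unique : ∀ g y → rel base y ≡ cl g → y ≡ pt g
  base-unique g y e with adm G.ε y g e
  ... | x′ , pt-x′≡y , ε\\x′≡g = trans (sym pt-x′≡y) (cong pt (trans (sym (G.ε\\ x′)) ε\\x′≡g))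

  cl-thin : ∀ g → Thin (cl g)
  cl-thin g = thin-from-point base (pt g) (cl g) (base-rel g) (base-unique g)

  -- The path base → pt g → pt (g ∙ h) shows cl (g ∙ h) ∈ {cl g}{cl h}.
  cl-product : ∀ g h → 0 < a (cl g) (cl h) (cl (g G.∙ h))
  cl-product g h = path⇒a-pos (base-rel (g G.∙ h)) (base-rel g)
                     (trans (hom g (g G.∙ h)) (cong cl (G.\\-leftDividesʳ g h)))

  -- Hence {cl g}{cl h} = {cl (g ∙ h)}, as the product of thin classes.
  cl-mult : ∀ g h r → (0 < a (cl g) (cl h) r) ⇔ (r ≡ cl (g G.∙ h))
  cl-mult g h r = mk⇔
    (λ pos → thin-product-unique (cl-thin g) (cl-thin h) pos (cl-product g h))
    (λ { refl → cl-product g h })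

  radHom : RadHom G T
  radHom = record { map = cl ; thin = cl-thin ; mult = cl-mult }

toRad : (G : FinGroup) (T : Scheme) → AdmMor (SRaw G) (Scheme.raw T) → RadHom G T
toRad = FromMorphism.radHom

module FromRadHom (G : FinGroup) (T : Scheme) (h : RadHom G T) where
  open Scheme T
  open SchemeFacts T
  module G = GroupFacts G
  open RadHom h

  base : Fin points
  base = proj₁ (nonempty one)

  pt : Fin G.order → Fin points
  pt g = proj₁ (reach base (map g))

  base-rel : ∀ g → rel base (pt g) ≡ map g
  base-rel g = proj₂ (reach base (map g))

  -- The class of (pt g₁ , pt g₂) is map (g₁ ⁻¹ ∙ g₂): the map (g₁ ⁻¹ ∙ g₂)-successor
  -- w of pt g₁ satisfies (base , w) ∈ map g₁ map (g₁ ⁻¹ ∙ g₂) = map g₂, so w = pt g₂.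
  pt-hom : ∀ g₁ g₂ → rel (pt g₁) (pt g₂) ≡ map ((g₁ G.⁻¹) G.∙ g₂)
  pt-hom g₁ g₂ with reach (pt g₁) (map ((g₁ G.⁻¹) G.∙ g₂))
  ... | w , pt-g₁→w = subst (λ v → rel (pt g₁) v ≡ _) w≡pt-g₂ pt-g₁→w
    where
      base→w : rel base w ≡ map g₂
      base→w = trans (Equivalence.to (mult g₁ _ (rel base w))
                        (path⇒a-pos refl (base-rel g₁) pt-g₁→w))
                     (cong map (G.\\-leftDividesˡ g₁ g₂))
      w≡pt-g₂ : w ≡ pt g₂
      w≡pt-g₂ = thin-unique (thin g₂) base→w (base-rel g₂)

  -- Admissibility: the map s-successor of pt g is pt (g ∙ s), by thinness.
  pt-adm : ∀ g y s → rel (pt g) y ≡ map s → ∃[ g′ ] (pt g′ ≡ y × (g G.⁻¹) G.∙ g′ ≡ s)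
  pt-adm g y s e =
    g G.∙ s
    , thin-unique (thin s) (trans (pt-hom g (g G.∙ s)) (cong map (G.\\-leftDividesʳ g s))) e
    , G.\\-leftDividesʳ g s

  morphism : AdmMor (SRaw G) raw
  morphism = record { pt = pt ; cl = map ; hom = pt-hom ; adm = pt-adm }

toRad-surjective : (G : FinGroup) (T : Scheme) (h : RadHom G T) →
                   ∃[ ψ ] RadHom≈ (toRad G T ψ) h
toRad-surjective G T h = FromRadHom.morphism G T h , λ _ → refl

-- Since toRad ψ has class map cl ψ, and algebraic equivalence is equality of
-- class maps, well-definedness, injectivity and both naturality squares hold
-- by definition.
proposition5p3 :
    Σ ((G : FinGroup) (T : Scheme) → AdmMor (SRaw G) (Scheme.raw T) → RadHom G T) λ Φ →
      ((G : FinGroup) (T : Scheme) (ψ ψ′ : AdmMor (SRaw G) (Scheme.raw T)) →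
        AlgEq ψ ψ′ → RadHom≈ (Φ G T ψ) (Φ G T ψ′))
      × ((G : FinGroup) (T : Scheme) (ψ ψ′ : AdmMor (SRaw G) (Scheme.raw T)) →
        RadHom≈ (Φ G T ψ) (Φ G T ψ′) → AlgEq ψ ψ′)
      × ((G : FinGroup) (T : Scheme) (h : RadHom G T) →
        ∃[ ψ ] RadHom≈ (Φ G T ψ) h)
      × ((G G′ : FinGroup) (T : Scheme) (f : GroupHom G′ G)
         (ψ : AdmMor (SRaw G) (Scheme.raw T)) (g : _) →
        RadHom.map (Φ G′ T (ψ ∘ₘ SMor f)) g
          ≡ RadHom.map (Φ G T ψ) (GroupHom.⟦_⟧ f g))
      × ((G : FinGroup) (T T′ : Scheme) (χ : AdmMor (Scheme.raw T) (Scheme.raw T′))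
         (ψ : AdmMor (SRaw G) (Scheme.raw T)) (g : _) →
        RadHom.map (Φ G T′ (χ ∘ₘ ψ)) g
          ≡ AdmMor.cl χ (RadHom.map (Φ G T ψ) g))
proposition5p3 =
  toRad
  , (λ _ _ _ _ same-classes → same-classes)
  , (λ _ _ _ _ same-maps → same-maps)
  , toRad-surjective
  , (λ _ _ _ _ _ _ → refl)
  , (λ _ _ _ _ _ _ → refl)
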